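{- Let $n_1\le n_2$ be positive integers and let $M(K(n_1,n_2))$ be the middle graph of the complete bipartite graph $K(n_1,n_2)$. Then $\chi_r(M(K(n_1,n_2)))=n_2+1$ if $r\le n_2$, and $\chi_r(M(K(n_1,n_2)))=n_2+2$ if $r=n_2+1$.
   Context: $K(n_1,n_2)$ is the complete bipartite graph with parts of sizes $n_1$ and $n_2$. The middle graph $M(G)$ of $G$ has vertex set $V(G)\cup E(G)$, two of its vertices being adjacent iff they are two edges of $G$ sharing an endpoint, or one is a vertex and the other an edge of $G$ incident with it. All graphs are simple, connected and undirected; $N_G(v)$ is the open neighborhood, $d(v)=|N_G(v)|$, $\Delta$ the maximum degree. For a coloring $c$ and vertex set $S$, $c(S)=\{c(u):u\in S\}$. For integers $k>0$ and $0<r\le\Delta(G)$ with $r\le k$, a conditional $(k,r)$-coloring of $G$ is a surjective map $c:V(G)\to\{1,\dots,k\}$ such that (C1) $c(u)\ne c(v)$ whenever $uv\in E(G)$, and (C2) $|c(N_G(v))|\ge\min\{d(v),r\}$ for every vertex $v$. $\chi_r(G)$ is the smallest $k$ for which $G$ has a conditional $(k,r)$-coloring. -}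

module Defs where

open import Data.Nat using (ℕ; zero; suc; _+_; _≤_; _<_; _⊔_; _⊓_)
open import Data.Bool using (Bool; true; false; _∧_; _∨_; not; if_then_else_)
open import Data.Fin using (Fin; splitAt; _≟_; _<?_)
open import Data.Sum using (_⊎_; inj₁; inj₂)
open import Data.Product using (_×_; _,_; proj₁; proj₂; ∃)
open import Data.List using (List; length; lookup; allFin; cartesianProduct; filterᵇ; map; foldr)
open import Data.Bool.ListAction using (any)
open import Relation.Nullary using (¬_)
open import Relation.Nullary.Decidable using (⌊_⌋)
open import Relation.Binary.PropositionalEquality using (_≡_; _≢_)

record Graph : Set where
  field
    n   : ℕ
    adj : Fin n → Fin n → Bool
open Graph public

_==_ : ∀ {m} → Fin m → Fin m → Bool
i == j = ⌊ i ≟ j ⌋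

-- Complete bipartite graph K(n1,n2): vertices 0..n1-1 form part 1,
-- vertices n1..n1+n2-1 form part 2.
K : ℕ → ℕ → Graph
K n1 n2 = record { n = n1 + n2 ; adj = a }
  where
  a : Fin (n1 + n2) → Fin (n1 + n2) → Bool
  a x y with splitAt n1 x | splitAt n1 y
  ... | inj₁ _ | inj₂ _ = true
  ... | inj₂ _ | inj₁ _ = true
  ... | _      | _      = false

edges : (G : Graph) → List (Fin (n G) × Fin (n G))
edges G = filterᵇ (λ p → ⌊ proj₁ p <? proj₂ p ⌋ ∧ adj G (proj₁ p) (proj₂ p))
                  (cartesianProduct (allFin (n G)) (allFin (n G)))

incident : ∀ {m} → Fin m → Fin m × Fin m → Bool
incident v (a , b) = (v == a) ∨ (v == b)

shareEnd : ∀ {m} → Fin m × Fin m → Fin m × Fin m → Bool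
shareEnd (a , b) e = incident a e ∨ incident b e

-- Middle graph M(G): vertex set V(G) ∪ E(G); the first n G vertices are the
-- vertices of G, the remaining ones are the edges of G (in the order of 'edges G').
middle : Graph → Graph
middle G = record { n = n G + length (edges G) ; adj = a }
  where
  E = edges G
  a : Fin (n G + length E) → Fin (n G + length E) → Bool
  a x y with splitAt (n G) x | splitAt (n G) y
  ... | inj₁ _ | inj₁ _ = false
  ... | inj₁ v | inj₂ e = incident v (lookup E e)
  ... | inj₂ e | inj₁ v = incident v (lookup E e)
  ... | inj₂ e | inj₂ f = not (e == f) ∧ shareEnd (lookup E e) (lookup E f)

countᵇ : ∀ {A : Set} → (A → Bool) → List A → ℕ
countᵇ p xs = length (filterᵇ p xs)

deg : (G : Graph) → Fin (n G) → ℕ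
deg G v = countᵇ (adj G v) (allFin (n G))

maxDeg : Graph → ℕ
maxDeg G = foldr _⊔_ 0 (map (deg G) (allFin (n G)))

nbColours : (G : Graph) {k : ℕ} → (Fin (n G) → Fin k) → Fin (n G) → ℕ
nbColours G {k} c v =
  countᵇ (λ col → any (λ u → adj G v u ∧ (c u == col)) (allFin (n G))) (allFin k)

-- c is a conditional (k,r)-colouring of G (colours 1..k encoded as Fin k);
-- includes the standing requirements k > 0, 0 < r ≤ Δ(G), r ≤ k.
IsCondColouring : (G : Graph) (k r : ℕ) → (Fin (n G) → Fin k) → Set
IsCondColouring G k r c =
    0 < k × 0 < r × r ≤ maxDeg G × r ≤ k
  × (∀ (col : Fin k) → ∃ λ u → c u ≡ col)
  × (∀ u v → adj G u v ≡ true → c u ≢ c v)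
  × (∀ v → deg G v ⊓ r ≤ nbColours G c v)

HasCondColouring : (G : Graph) (k r : ℕ) → Set
HasCondColouring G k r = ∃ λ (c : Fin (n G) → Fin k) → IsCondColouring G k r c

ChiR≡ : (G : Graph) (r k : ℕ) → Set
ChiR≡ G r k = HasCondColouring G k r × (∀ k' → k' < k → ¬ HasCondColouring G k' r)

-- Place the vertices of M(K(n₁,n₂)) in an (n₂+1) × (n₂+1) grid: the edge ij of K in cell (i, j),
-- the vertex i of the first part in cell (i, n₂) and the vertex j of the second part in cell (n₂, j).
-- Adjacent vertices of the middle graph then share a row or a column, so the Latin-square colouring
-- (a + b) mod (n₂ + 1) is proper with n₂ + 1 colours.  It satisfies (C2) for r ≤ n₂ because the
-- neighbourhood of an original vertex is a clique and an edge vertex sees its n₂ row-mates.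
-- Conversely, a vertex of the first part together with its n₂ edges is a clique of size n₂ + 1.
-- For r = n₂ + 1, an edge vertex has at least n₂ + 1 neighbours, so (C2) puts n₂ + 1 colours on its
-- neighbourhood, none of them its own: n₂ + 2 colours are needed, and recolouring the second part
-- with one fresh colour shows that they suffice.

module Submission where

open import Defs
open import Data.Bool using (Bool; true; false; T; not; _∧_)
open import Data.Bool.ListAction using (any)
open import Data.Bool.Properties using (T?; T-≡; T-∧; T-∨)
open import Data.Empty using (⊥-elim)
open import Data.Fin as Fin using (Fin; toℕ; fromℕ<; punchIn; _↑ˡ_; _↑ʳ_; splitAt)
open import Data.Fin.Properties
  using ( injective⇒≤; toℕ-injective; toℕ-fromℕ<; toℕ<n; punchIn-injective; punchInᵢ≢i
        ; ↑ˡ-injective; ↑ʳ-injective; toℕ-↑ˡ; toℕ-↑ʳ; splitAt-↑ˡ; splitAt-↑ʳ; splitAt⁻¹-↑ˡ; splitAt⁻¹-↑ʳ )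
open import Data.List using (List; []; _∷_; length; lookup; map; foldr; filterᵇ; allFin; cartesianProduct)
open import Data.List.Membership.Propositional using (_∈_)
open import Data.List.Membership.Propositional.Properties
  using (∈-lookup; ∈-allFin; ∈-map⁺; ∈-map⁻; ∈-filter⁺; ∈-filter⁻; ∈-cartesianProduct⁺)
open import Data.List.Properties using (length-map; length-tabulate; filter-notAll)
open import Data.List.Relation.Binary.Subset.Propositional using (_⊆_)
open import Data.List.Relation.Unary.All as All using (All; []; _∷_)
import Data.List.Relation.Unary.All.Properties as All
open import Data.List.Relation.Unary.AllPairs as AllPairs using (AllPairs; []; _∷_)
import Data.List.Relation.Unary.AllPairs.Properties as AllPairs
open import Data.List.Relation.Unary.Any as Any using (here; there)
open import Data.List.Relation.Unary.Any.Properties using (lookup-index; any⁺; any⁻)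
open import Data.List.Relation.Unary.Unique.Propositional using (Unique)
import Data.List.Relation.Unary.Unique.Propositional.Properties as Unique
open import Data.Nat using (ℕ; suc; s≤s; z≤n; s≤s⁻¹; _+_; _∸_; _≤_; _<_; _⊔_; _⊓_; NonZero)
open import Data.Nat.DivMod using (_%_; %-distribˡ-+; m%n%n≡m%n; [m+n]%n≡m%n; m<n⇒m%n≡m; m%n<n; m≤n⇒m%n≡m)
open import Data.Nat.Properties
  using ( ≤-refl; ≤-trans; <-≤-trans; ≤-<-trans; <-irrefl; <⇒≤; <⇒≯; <⇒≱; n≤1+n; m≤n⇒m≤1+n
        ; m≤n⇒m<n∨m≡n; m≤m+n; +-comm; +-assoc; +-suc; +-monoʳ-≤; m+[n∸m]≡n
        ; m≤m⊔n; m≤n⊔m; m⊓n≤m; m⊓n≤n; m≥n⇒m⊓n≡n )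
open import Data.Product using (_×_; _,_; proj₁; proj₂; ∃)
open import Data.Sum as Sum using (_⊎_; inj₁; inj₂)
open import Function using (_∘_; case_of_; Equivalence)
open import Relation.Binary.PropositionalEquality
open import Relation.Nullary using (¬_; contradiction)
open import Relation.Nullary.Decidable using (⌊_⌋; fromWitness; toWitness; fromWitnessFalse; toWitnessFalse)

open Equivalence using (to; from)

private
  variable
    A : Set

lookup-injective : {xs : List A} → Unique xs → ∀ i j → lookup xs i ≡ lookup xs j → i ≡ j
lookup-injective (_ ∷ _)     Fin.zero    Fin.zero    _  = refl
lookup-injective (x∉xs ∷ _)  Fin.zero    (Fin.suc j) eq = contradiction eq (All.lookup x∉xs (∈-lookup j))
lookup-injective (x∉xs ∷ _)  (Fin.suc i) Fin.zero    eq = contradiction (sym eq) (All.lookup x∉xs (∈-lookup i))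
lookup-injective (_ ∷ xs!)   (Fin.suc i) (Fin.suc j) eq = cong Fin.suc (lookup-injective xs! i j eq)

Unique-⊆⇒length≤ : {xs ys : List A} → Unique xs → xs ⊆ ys → length xs ≤ length ys
Unique-⊆⇒length≤ {xs = xs} {ys} xs! xs⊆ys = injective⇒≤ {f = position} position-injective
  where
  position : Fin (length xs) → Fin (length ys)
  position i = Any.index (xs⊆ys (∈-lookup i))

  lookup-position : ∀ i → lookup ys (position i) ≡ lookup xs i
  lookup-position i = sym (lookup-index (xs⊆ys (∈-lookup i)))

  position-injective : ∀ {i j} → position i ≡ position j → i ≡ j
  position-injective {i} {j} eq = lookup-injective xs! i j (begin
    lookup xs i             ≡⟨ lookup-position i ⟨
    lookup ys (position i)  ≡⟨ cong (lookup ys) eq ⟩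
    lookup ys (position j)  ≡⟨ lookup-position j ⟩
    lookup xs j             ∎)
    where open ≡-Reasoning

Unique⇒AllPairs : ∀ {R : A → A → Set} {xs : List A} → Unique xs →
                  (∀ {x y} → x ∈ xs → y ∈ xs → x ≢ y → R x y) → AllPairs R xs
Unique⇒AllPairs []            R-on-xs = []
Unique⇒AllPairs (x∉xs ∷ xs!) R-on-xs =
  All.tabulate (λ y∈xs → R-on-xs (here refl) (there y∈xs) (All.lookup x∉xs y∈xs))
  ∷ Unique⇒AllPairs xs! (λ x∈xs y∈xs → R-on-xs (there x∈xs) (there y∈xs))

length-allFin : ∀ n → length (allFin n) ≡ n
length-allFin n = length-tabulate {n = n} (λ i → i)

∈⇒≤foldr-⊔ : ∀ {m ms} → m ∈ ms → m ≤ foldr _⊔_ 0 ms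
∈⇒≤foldr-⊔ {ms = m ∷ ms} (here refl) = m≤m⊔n m _
∈⇒≤foldr-⊔ {ms = m ∷ ms} (there m∈ms) = ≤-trans (∈⇒≤foldr-⊔ m∈ms) (m≤n⊔m m _)

allFinExcept : ∀ {n} → Fin n → List (Fin n)
allFinExcept {suc n} j = map (punchIn j) (allFin n)

length-allFinExcept : ∀ {n} (j : Fin n) → suc (length (allFinExcept j)) ≡ n
length-allFinExcept {suc n} j = cong suc (trans (length-map (punchIn j) (allFin n)) (length-allFin n))

allFinExcept⁺ : ∀ {n} (j : Fin n) → Unique (allFinExcept j)
allFinExcept⁺ {suc n} j = Unique.map⁺ (punchIn-injective j _ _) (Unique.allFin⁺ n)

allFinExcept-≢ : ∀ {n} (j : Fin n) → All (_≢ j) (allFinExcept j)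
allFinExcept-≢ {suc n} j = All.tabulate λ j′∈ → case ∈-map⁻ (punchIn j) j′∈ of λ where
  (k , _ , refl) → punchInᵢ≢i j k

-- Conditional colourings of arbitrary graphs

Adj : (G : Graph) → Fin (n G) → Fin (n G) → Set
Adj G u v = T (adj G u v)

neighbours : (G : Graph) → Fin (n G) → List (Fin (n G))
neighbours G v = filterᵇ (adj G v) (allFin (n G))

neighbours-Adj : ∀ G v → All (Adj G v) (neighbours G v)
neighbours-Adj G v = All.all-filter (T? ∘ adj G v) (allFin (n G))

neighbours⁺ : ∀ G v → Unique (neighbours G v)
neighbours⁺ G v = Unique.filter⁺ (T? ∘ adj G v) (Unique.allFin⁺ (n G))

length≤deg : ∀ G {v xs} → Unique xs → All (Adj G v) xs → length xs ≤ deg G v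
length≤deg G {v} xs! v~xs =
  Unique-⊆⇒length≤ xs! (λ u∈xs → ∈-filter⁺ (T? ∘ adj G v) (∈-allFin _) (All.lookup v~xs u∈xs))

deg≤maxDeg : ∀ G v → deg G v ≤ maxDeg G
deg≤maxDeg G v = ∈⇒≤foldr-⊔ (∈-map⁺ (deg G) (∈-allFin v))

NbhdIsClique : (G : Graph) → Fin (n G) → Set
NbhdIsClique G v = ∀ {u w} → Adj G v u → Adj G v w → u ≢ w → Adj G u w

Proper : (G : Graph) {k : ℕ} → (Fin (n G) → Fin k) → Set
Proper G c = ∀ u v → adj G u v ≡ true → c u ≢ c v

module ProperColouring (G : Graph) {k : ℕ} (c : Fin (n G) → Fin k) (proper : Proper G c) where

  private
    seen : Fin (n G) → Fin k → Bool
    seen v col = any (λ u → adj G v u ∧ (c u == col)) (allFin (n G))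

  clique⇒Unique-colours : ∀ {xs} → AllPairs (Adj G) xs → Unique (map c xs)
  clique⇒Unique-colours = AllPairs.map⁺ ∘ AllPairs.map (λ {u} {w} u~w → proper u w (to T-≡ u~w))

  clique-length≤k : ∀ {xs} → AllPairs (Adj G) xs → length xs ≤ k
  clique-length≤k {xs} clique = subst₂ _≤_ (length-map c xs) (length-allFin k)
    (Unique-⊆⇒length≤ (clique⇒Unique-colours clique) (λ _ → ∈-allFin _))

  length≤nbColours : ∀ {v xs} → All (Adj G v) xs → Unique (map c xs) → length xs ≤ nbColours G c v
  length≤nbColours {v} {xs} v~xs colours! = subst (_≤ nbColours G c v) (length-map c xs)
    (Unique-⊆⇒length≤ colours! colour-seen)
    where
    colour-seen : map c xs ⊆ filterᵇ (seen v) (allFin k)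
    colour-seen col∈ with ∈-map⁻ c col∈
    ... | w , w∈xs , refl = ∈-filter⁺ (T? ∘ seen v) (∈-allFin _)
      (any⁺ _ (Any.map (λ { refl → from T-∧ (All.lookup v~xs w∈xs , fromWitness refl) }) (∈-allFin w)))

  nbColours<k : ∀ v → nbColours G c v < k
  nbColours<k v = subst (nbColours G c v <_) (length-allFin k)
    (filter-notAll (T? ∘ seen v) (allFin k) (Any.map (λ { refl → own-colour-unseen }) (∈-allFin (c v))))
    where
    own-colour-unseen : ¬ T (seen v (c v))
    own-colour-unseen t with Any.satisfied (any⁻ _ (allFin (n G)) t)
    ... | u , v~u,cu≡cv with to T-∧ v~u,cu≡cv
    ... | v~u , cu≡cv = proper v u (to T-≡ v~u) (sym (toWitness cu≡cv))

  NbhdIsClique⇒deg≤nbColours : ∀ {v} → NbhdIsClique G v → deg G v ≤ nbColours G c v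
  NbhdIsClique⇒deg≤nbColours {v} clique = length≤nbColours (neighbours-Adj G v)
    (clique⇒Unique-colours (Unique⇒AllPairs (neighbours⁺ G v) λ u∈ w∈ →
      clique (All.lookup (neighbours-Adj G v) u∈) (All.lookup (neighbours-Adj G v) w∈)))

HasCondColouring⇒clique≤k : ∀ {G k r xs} → HasCondColouring G k r → AllPairs (Adj G) xs → length xs ≤ k
HasCondColouring⇒clique≤k {G} (c , _ , _ , _ , _ , _ , proper , _) =
  ProperColouring.clique-length≤k G c proper

HasCondColouring⇒r<k : ∀ {G k r} v → HasCondColouring G k r → r ≤ deg G v → r < k
HasCondColouring⇒r<k {G} v (c , _ , _ , _ , _ , _ , proper , C2) r≤deg = ≤-<-trans
  (subst (_≤ nbColours G c v) (m≥n⇒m⊓n≡n r≤deg) (C2 v))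
  (ProperColouring.nbColours<k G c proper v)

ChiR≡-intro : ∀ {G r k} → HasCondColouring G k r → (∀ {k′} → HasCondColouring G k′ r → k ≤ k′) → ChiR≡ G r k
ChiR≡-intro has lower = has , λ k′ k′<k has′ → <⇒≱ k′<k (lower has′)

-- Middle graphs and complete bipartite graphs

data SplitView (m n : ℕ) : Fin (m + n) → Set where
  inˡ : ∀ i → SplitView m n (i ↑ˡ n)
  inʳ : ∀ j → SplitView m n (m ↑ʳ j)

splitView : ∀ m n (i : Fin (m + n)) → SplitView m n i
splitView m n i with splitAt m i in eq
... | inj₁ i′ = subst (SplitView m n) (splitAt⁻¹-↑ˡ eq) (inˡ i′)
... | inj₂ j′ = subst (SplitView m n) (splitAt⁻¹-↑ʳ eq) (inʳ j′)

↑ˡ<↑ʳ : ∀ {m} n (i : Fin m) (j : Fin n) → toℕ (i ↑ˡ n) < toℕ (m ↑ʳ j)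
↑ˡ<↑ʳ {m} n i j rewrite toℕ-↑ˡ i n | toℕ-↑ʳ m j = <-≤-trans (toℕ<n i) (m≤m+n m (toℕ j))

↑ˡ≢↑ʳ : ∀ {m} n (i : Fin m) (j : Fin n) → i ↑ˡ n ≢ m ↑ʳ j
↑ˡ≢↑ʳ n i j eq = <-irrefl (cong toℕ eq) (↑ˡ<↑ʳ n i j)

incident⁻ : ∀ {m} {x a b : Fin m} → T (incident x (a , b)) → x ≡ a ⊎ x ≡ b
incident⁻ {x = x} {a} {b} x~ab = Sum.map toWitness toWitness (to (T-∨ {x == a} {x == b}) x~ab)

incidentˡ : ∀ {m} (a b : Fin m) → T (incident a (a , b))
incidentˡ a b = from (T-∨ {a == a} {a == b}) (inj₁ (fromWitness refl))

incidentʳ : ∀ {m} (a b : Fin m) → T (incident b (a , b))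
incidentʳ a b = from (T-∨ {b == a} {b == b}) (inj₂ (fromWitness refl))

isEdge : (G : Graph) → Fin (n G) × Fin (n G) → Bool
isEdge G (a , b) = ⌊ a Fin.<? b ⌋ ∧ adj G a b

edges⁺ : ∀ G → Unique (edges G)
edges⁺ G = Unique.filter⁺ (T? ∘ isEdge G) (Unique.cartesianProduct⁺ (Unique.allFin⁺ (n G)) (Unique.allFin⁺ (n G)))

∈edges⁻ : ∀ G {p} → p ∈ edges G → T (isEdge G p)
∈edges⁻ G p∈ = proj₂ (∈-filter⁻ (T? ∘ isEdge G) {xs = cartesianProduct (allFin (n G)) (allFin (n G))} p∈)

module _ (G : Graph) where

  private
    L = length (edges G)

  vertexᴹ : Fin (n G) → Fin (n (middle G))
  vertexᴹ x = x ↑ˡ L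

  edgeᴹ : Fin L → Fin (n (middle G))
  edgeᴹ e = n G ↑ʳ e

  middle-adj-vertex-vertex : ∀ x y → adj (middle G) (vertexᴹ x) (vertexᴹ y) ≡ false
  middle-adj-vertex-vertex x y rewrite splitAt-↑ˡ (n G) x L | splitAt-↑ˡ (n G) y L = refl

  middle-adj-vertex-edge : ∀ x e → adj (middle G) (vertexᴹ x) (edgeᴹ e) ≡ incident x (lookup (edges G) e)
  middle-adj-vertex-edge x e rewrite splitAt-↑ˡ (n G) x L | splitAt-↑ʳ (n G) L e = refl

  middle-adj-edge-vertex : ∀ e x → adj (middle G) (edgeᴹ e) (vertexᴹ x) ≡ incident x (lookup (edges G) e)
  middle-adj-edge-vertex e x rewrite splitAt-↑ˡ (n G) x L | splitAt-↑ʳ (n G) L e = refl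

  middle-adj-edge-edge : ∀ e f → adj (middle G) (edgeᴹ e) (edgeᴹ f)
                                 ≡ not (e == f) ∧ shareEnd (lookup (edges G) e) (lookup (edges G) f)
  middle-adj-edge-edge e f rewrite splitAt-↑ʳ (n G) L e | splitAt-↑ʳ (n G) L f = refl

  middle-vertex-NbhdIsClique : ∀ x → NbhdIsClique (middle G) (vertexᴹ x)
  middle-vertex-NbhdIsClique x {u} {w} x~u x~w u≢w
    with splitView (n G) L u | splitView (n G) L w
  ... | inˡ y | _     = contradiction (subst T (middle-adj-vertex-vertex x y) x~u) λ ()
  ... | inʳ e | inˡ y = contradiction (subst T (middle-adj-vertex-vertex x y) x~w) λ ()
  ... | inʳ e | inʳ f = subst T (sym (middle-adj-edge-edge e f))
        (from T-∧ (fromWitnessFalse (u≢w ∘ cong edgeᴹ) , shared (lookup (edges G) e) x∈e))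
    where
    x∈e : T (incident x (lookup (edges G) e))
    x∈e = subst T (middle-adj-vertex-edge x e) x~u

    x∈f : T (incident x (lookup (edges G) f))
    x∈f = subst T (middle-adj-vertex-edge x f) x~w

    shared : ∀ p → T (incident x p) → T (shareEnd p (lookup (edges G) f))
    shared (a , b) x∈ab with incident⁻ {x = x} {a} {b} x∈ab
    ... | inj₁ refl = from (T-∨ {incident a _} {incident b _}) (inj₁ x∈f)
    ... | inj₂ refl = from (T-∨ {incident a _} {incident b _}) (inj₂ x∈f)

module _ (n₁ n₂ : ℕ) where

  K-adj-↑ˡ-↑ʳ : ∀ i j → adj (K n₁ n₂) (i ↑ˡ n₂) (n₁ ↑ʳ j) ≡ true
  K-adj-↑ˡ-↑ʳ i j rewrite splitAt-↑ˡ n₁ i n₂ | splitAt-↑ʳ n₁ n₂ j = refl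

  K-adj-↑ˡ-↑ˡ : ∀ i i′ → adj (K n₁ n₂) (i ↑ˡ n₂) (i′ ↑ˡ n₂) ≡ false
  K-adj-↑ˡ-↑ˡ i i′ rewrite splitAt-↑ˡ n₁ i n₂ | splitAt-↑ˡ n₁ i′ n₂ = refl

  K-adj-↑ʳ-↑ʳ : ∀ j j′ → adj (K n₁ n₂) (n₁ ↑ʳ j) (n₁ ↑ʳ j′) ≡ false
  K-adj-↑ʳ-↑ʳ j j′ rewrite splitAt-↑ʳ n₁ n₂ j | splitAt-↑ʳ n₁ n₂ j′ = refl

  ↑ˡ,↑ʳ∈edges-K : ∀ i j → (i ↑ˡ n₂ , n₁ ↑ʳ j) ∈ edges (K n₁ n₂)
  ↑ˡ,↑ʳ∈edges-K i j = ∈-filter⁺ (T? ∘ isEdge (K n₁ n₂)) (∈-cartesianProduct⁺ (∈-allFin _) (∈-allFin _))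
    (from (T-∧ {⌊ i ↑ˡ n₂ Fin.<? n₁ ↑ʳ j ⌋}) (fromWitness (↑ˡ<↑ʳ n₂ i j) , subst T (sym (K-adj-↑ˡ-↑ʳ i j)) _))

  ∈edges-K⁻ : ∀ {p} → p ∈ edges (K n₁ n₂) → ∃ λ i → ∃ λ j → p ≡ (i ↑ˡ n₂ , n₁ ↑ʳ j)
  ∈edges-K⁻ {a , b} ab∈ with splitView n₁ n₂ a | splitView n₁ n₂ b | to (T-∧ {⌊ a Fin.<? b ⌋}) (∈edges⁻ (K n₁ n₂) ab∈)
  ... | inˡ i | inʳ j  | _       = i , j , refl
  ... | inˡ i | inˡ i′ | _ , a~b = contradiction (subst T (K-adj-↑ˡ-↑ˡ i i′) a~b) λ ()
  ... | inʳ j | inʳ j′ | _ , a~b = contradiction (subst T (K-adj-↑ʳ-↑ʳ j j′) a~b) λ ()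
  ... | inʳ j | inˡ i  | a<b , _ = contradiction (toWitness a<b) (<⇒≯ (↑ˡ<↑ʳ n₂ i j))

[m%n+o]%n≡[m+o]%n : ∀ m o n .{{_ : NonZero n}} → (m % n + o) % n ≡ (m + o) % n
[m%n+o]%n≡[m+o]%n m o n = begin
  (m % n + o) % n          ≡⟨ %-distribˡ-+ (m % n) o n ⟩
  (m % n % n + o % n) % n  ≡⟨ cong (λ x → (x + o % n) % n) (m%n%n≡m%n m n) ⟩
  (m % n + o % n) % n      ≡⟨ %-distribˡ-+ m o n ⟨
  (m + o) % n              ∎
  where open ≡-Reasoning

+-%-cancelˡ : ∀ {n a b} c .{{_ : NonZero n}} → c ≤ n → a < n → b < n → (c + a) % n ≡ (c + b) % n → a ≡ b
+-%-cancelˡ {n} {a} {b} c c≤n a<n b<n eq = begin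
  a                              ≡⟨ undo-shift a<n ⟨
  ((c + a) % n + (n ∸ c)) % n    ≡⟨ cong (λ x → (x + (n ∸ c)) % n) eq ⟩
  ((c + b) % n + (n ∸ c)) % n    ≡⟨ undo-shift b<n ⟩
  b                              ∎
  where
  open ≡-Reasoning
  undo-shift : ∀ {x} → x < n → ((c + x) % n + (n ∸ c)) % n ≡ x
  undo-shift {x} x<n = begin
    ((c + x) % n + (n ∸ c)) % n  ≡⟨ [m%n+o]%n≡[m+o]%n (c + x) (n ∸ c) n ⟩
    (c + x + (n ∸ c)) % n        ≡⟨ cong (_% n) (+-rearrange) ⟩
    (x + n) % n                  ≡⟨ [m+n]%n≡m%n x n ⟩
    x % n                        ≡⟨ m<n⇒m%n≡m x<n ⟩
    x                            ∎
    where
    +-rearrange : c + x + (n ∸ c) ≡ x + n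
    +-rearrange = begin
      c + x + (n ∸ c)    ≡⟨ cong (_+ (n ∸ c)) (+-comm c x) ⟩
      x + c + (n ∸ c)    ≡⟨ +-assoc x c (n ∸ c) ⟩
      x + (c + (n ∸ c))  ≡⟨ cong (x +_) (m+[n∸m]≡n c≤n) ⟩
      x + n              ∎

-- The middle graph of K(n₁,n₂)

module MiddleK (n₁ n₂ : ℕ) where

  private
    KG = K n₁ n₂
    E  = edges KG
    MG = middle KG

  edgeIndex : Fin n₁ → Fin n₂ → Fin (length E)
  edgeIndex i j = Any.index (↑ˡ,↑ʳ∈edges-K n₁ n₂ i j)

  lookup-edgeIndex : ∀ i j → lookup E (edgeIndex i j) ≡ (i ↑ˡ n₂ , n₁ ↑ʳ j)
  lookup-edgeIndex i j = sym (lookup-index (↑ˡ,↑ʳ∈edges-K n₁ n₂ i j))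

  edgeIndex-injective : ∀ {i i′ j j′} → edgeIndex i j ≡ edgeIndex i′ j′ → i ≡ i′ × j ≡ j′
  edgeIndex-injective {i} {i′} {j} {j′} eq =
    ↑ˡ-injective n₂ i i′ (cong proj₁ same-ends) , ↑ʳ-injective n₁ j j′ (cong proj₂ same-ends)
    where
    same-ends : (i ↑ˡ n₂ , n₁ ↑ʳ j) ≡ (i′ ↑ˡ n₂ , n₁ ↑ʳ j′)
    same-ends = trans (sym (lookup-edgeIndex i j)) (trans (cong (lookup E) eq) (lookup-edgeIndex i′ j′))

  data Vertex : Set where
    part₁ : Fin n₁ → Vertex
    part₂ : Fin n₂ → Vertex
    edge  : Fin n₁ → Fin n₂ → Vertex

  embed : Vertex → Fin (n MG)
  embed (part₁ i)  = vertexᴹ KG (i ↑ˡ n₂)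
  embed (part₂ j)  = vertexᴹ KG (n₁ ↑ʳ j)
  embed (edge i j) = edgeᴹ KG (edgeIndex i j)

  embed-surjective : ∀ u → ∃ λ w → embed w ≡ u
  embed-surjective u with splitView (n₁ + n₂) (length E) u
  ... | inʳ e with ∈edges-K⁻ n₁ n₂ (∈-lookup e)
  ...   | i , j , eq = edge i j ,
          cong (edgeᴹ KG) (lookup-injective (edges⁺ KG) _ _ (trans (lookup-edgeIndex i j) (sym eq)))
  embed-surjective u | inˡ x with splitView n₁ n₂ x
  ... | inˡ i = part₁ i , refl
  ... | inʳ j = part₂ j , refl

  embed-injective : ∀ {w w′} → embed w ≡ embed w′ → w ≡ w′
  embed-injective {part₁ i}  {part₁ i′}   eq = cong part₁ (↑ˡ-injective n₂ i i′ (↑ˡ-injective (length E) _ _ eq))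
  embed-injective {part₁ i}  {part₂ j}    eq = contradiction (↑ˡ-injective (length E) _ _ eq) (↑ˡ≢↑ʳ n₂ i j)
  embed-injective {part₂ j}  {part₁ i}    eq = contradiction (↑ˡ-injective (length E) _ _ (sym eq)) (↑ˡ≢↑ʳ n₂ i j)
  embed-injective {part₂ j}  {part₂ j′}   eq = cong part₂ (↑ʳ-injective n₁ j j′ (↑ˡ-injective (length E) _ _ eq))
  embed-injective {part₁ _}  {edge _ _}   eq = contradiction eq (↑ˡ≢↑ʳ (length E) _ _)
  embed-injective {part₂ _}  {edge _ _}   eq = contradiction eq (↑ˡ≢↑ʳ (length E) _ _)
  embed-injective {edge _ _} {part₁ _}    eq = contradiction (sym eq) (↑ˡ≢↑ʳ (length E) _ _)
  embed-injective {edge _ _} {part₂ _}    eq = contradiction (sym eq) (↑ˡ≢↑ʳ (length E) _ _)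
  embed-injective {edge _ _} {edge _ _}   eq with edgeIndex-injective (↑ʳ-injective (n₁ + n₂) _ _ eq)
  ... | refl , refl = refl

  decode : Fin (n MG) → Vertex
  decode u = proj₁ (embed-surjective u)

  embed-decode : ∀ u → embed (decode u) ≡ u
  embed-decode u = proj₂ (embed-surjective u)

  decode-embed : ∀ w → decode (embed w) ≡ w
  decode-embed w = embed-injective (embed-decode (embed w))

  infix 4 _~_
  data _~_ : Vertex → Vertex → Set where
    part₁~edge : ∀ {i j} → part₁ i ~ edge i j
    edge~part₁ : ∀ {i j} → edge i j ~ part₁ i
    part₂~edge : ∀ {i j} → part₂ j ~ edge i j
    edge~part₂ : ∀ {i j} → edge i j ~ part₂ j
    sameRow    : ∀ {i j j′} → j ≢ j′ → edge i j ~ edge i j′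
    sameCol    : ∀ {i i′ j} → i ≢ i′ → edge i j ~ edge i′ j

  private
    ends : Fin n₁ → Fin n₂ → Fin (n₁ + n₂) × Fin (n₁ + n₂)
    ends i j = i ↑ˡ n₂ , n₁ ↑ʳ j

    adj-vertex-vertex : ∀ {x y} → ¬ Adj MG (vertexᴹ KG x) (vertexᴹ KG y)
    adj-vertex-vertex {x} {y} x~y = contradiction (subst T (middle-adj-vertex-vertex KG x y) x~y) λ ()

    adj-vertex-edge : ∀ x i j → adj MG (vertexᴹ KG x) (embed (edge i j)) ≡ incident x (ends i j)
    adj-vertex-edge x i j = trans (middle-adj-vertex-edge KG x (edgeIndex i j)) (cong (incident x) (lookup-edgeIndex i j))

    adj-edge-vertex : ∀ i j x → adj MG (embed (edge i j)) (vertexᴹ KG x) ≡ incident x (ends i j)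
    adj-edge-vertex i j x = trans (middle-adj-edge-vertex KG (edgeIndex i j) x) (cong (incident x) (lookup-edgeIndex i j))

    adj-edge-edge : ∀ i j i′ j′ → adj MG (embed (edge i j)) (embed (edge i′ j′))
                                  ≡ not (edgeIndex i j == edgeIndex i′ j′) ∧ shareEnd (ends i j) (ends i′ j′)
    adj-edge-edge i j i′ j′ = trans (middle-adj-edge-edge KG (edgeIndex i j) (edgeIndex i′ j′))
      (cong₂ (λ p q → not (edgeIndex i j == edgeIndex i′ j′) ∧ shareEnd p q) (lookup-edgeIndex i j) (lookup-edgeIndex i′ j′))

    ↑ˡ-incident⁻ : ∀ {i i′ j} → T (incident (i ↑ˡ n₂) (ends i′ j)) → i ≡ i′
    ↑ˡ-incident⁻ {i} {i′} {j} i∈ with incident⁻ {x = i ↑ˡ n₂} i∈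
    ... | inj₁ eq = ↑ˡ-injective n₂ i i′ eq
    ... | inj₂ eq = contradiction eq (↑ˡ≢↑ʳ n₂ i j)

    ↑ʳ-incident⁻ : ∀ {i j j′} → T (incident (n₁ ↑ʳ j) (ends i j′)) → j ≡ j′
    ↑ʳ-incident⁻ {i} {j} {j′} j∈ with incident⁻ {x = n₁ ↑ʳ j} j∈
    ... | inj₁ eq = contradiction (sym eq) (↑ˡ≢↑ʳ n₂ i j)
    ... | inj₂ eq = ↑ʳ-injective n₁ j j′ eq

    shareEnd⁻ : ∀ {i j i′ j′} → T (shareEnd (ends i j) (ends i′ j′)) → i ≡ i′ ⊎ j ≡ j′
    shareEnd⁻ {i} {j} {i′} {j′} shared =
      Sum.map ↑ˡ-incident⁻ ↑ʳ-incident⁻ (to (T-∨ {incident (i ↑ˡ n₂) (ends i′ j′)}) shared)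

  adj⇒~ : ∀ {w w′} → Adj MG (embed w) (embed w′) → w ~ w′
  adj⇒~ {part₁ _}  {part₁ _}  = ⊥-elim ∘ adj-vertex-vertex
  adj⇒~ {part₁ _}  {part₂ _}  = ⊥-elim ∘ adj-vertex-vertex
  adj⇒~ {part₂ _}  {part₁ _}  = ⊥-elim ∘ adj-vertex-vertex
  adj⇒~ {part₂ _}  {part₂ _}  = ⊥-elim ∘ adj-vertex-vertex
  adj⇒~ {part₁ i}  {edge i′ j} i~e with ↑ˡ-incident⁻ {i} {i′} {j} (subst T (adj-vertex-edge (i ↑ˡ n₂) i′ j) i~e)
  ... | refl = part₁~edge
  adj⇒~ {part₂ j}  {edge i j′} j~e with ↑ʳ-incident⁻ {i} {j} {j′} (subst T (adj-vertex-edge (n₁ ↑ʳ j) i j′) j~e)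
  ... | refl = part₂~edge
  adj⇒~ {edge i j} {part₁ i′} e~i with ↑ˡ-incident⁻ {i′} {i} {j} (subst T (adj-edge-vertex i j (i′ ↑ˡ n₂)) e~i)
  ... | refl = edge~part₁
  adj⇒~ {edge i j} {part₂ j′} e~j with ↑ʳ-incident⁻ {i} {j′} {j} (subst T (adj-edge-vertex i j (n₁ ↑ʳ j′)) e~j)
  ... | refl = edge~part₂
  adj⇒~ {edge i j} {edge i′ j′} e~f
    with to (T-∧ {not (edgeIndex i j == edgeIndex i′ j′)}) (subst T (adj-edge-edge i j i′ j′) e~f)
  ... | e≢f , shared with shareEnd⁻ {i} {j} {i′} {j′} shared
  ...   | inj₁ refl = sameRow (λ j≡j′ → toWitnessFalse e≢f (cong (edgeIndex i) j≡j′))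
  ...   | inj₂ refl = sameCol (λ i≡i′ → toWitnessFalse e≢f (cong (λ i → edgeIndex i j) i≡i′))

  ~⇒adj : ∀ {w w′} → w ~ w′ → Adj MG (embed w) (embed w′)
  ~⇒adj {part₁ i} {edge _ j} part₁~edge = subst T (sym (adj-vertex-edge _ i j)) (incidentˡ (i ↑ˡ n₂) (n₁ ↑ʳ j))
  ~⇒adj {edge i j} {part₁ _} edge~part₁ = subst T (sym (adj-edge-vertex i j _)) (incidentˡ (i ↑ˡ n₂) (n₁ ↑ʳ j))
  ~⇒adj {part₂ j} {edge i _} part₂~edge = subst T (sym (adj-vertex-edge _ i j)) (incidentʳ (i ↑ˡ n₂) (n₁ ↑ʳ j))
  ~⇒adj {edge i j} {part₂ _} edge~part₂ = subst T (sym (adj-edge-vertex i j _)) (incidentʳ (i ↑ˡ n₂) (n₁ ↑ʳ j))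
  ~⇒adj {edge i j} {edge _ j′} (sameRow j≢j′) = subst T (sym (adj-edge-edge i j i j′))
    (from T-∧ (fromWitnessFalse (j≢j′ ∘ proj₂ ∘ edgeIndex-injective) ,
               from (T-∨ {incident (i ↑ˡ n₂) (ends i j′)}) (inj₁ (incidentˡ (i ↑ˡ n₂) (n₁ ↑ʳ j′)))))
  ~⇒adj {edge i j} {edge i′ _} (sameCol i≢i′) = subst T (sym (adj-edge-edge i j i′ j))
    (from T-∧ (fromWitnessFalse (i≢i′ ∘ proj₁ ∘ edgeIndex-injective) ,
               from (T-∨ {incident (i ↑ˡ n₂) (ends i′ j)}) (inj₂ (incidentʳ (i′ ↑ˡ n₂) (n₁ ↑ʳ j)))))

  ~⇒≢ : ∀ {w w′} → w ~ w′ → w ≢ w′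
  ~⇒≢ (sameRow j≢j) refl = j≢j refl
  ~⇒≢ (sameCol i≢i) refl = i≢i refl

  row : Fin n₁ → List (Fin n₂) → List Vertex
  row i js = part₁ i ∷ map (edge i) js

  length-embed-row : ∀ i js → length (map embed (row i js)) ≡ suc (length js)
  length-embed-row i js = trans (length-map embed (row i js)) (cong suc (length-map (edge i) js))

  row-clique : ∀ i {js} → Unique js → AllPairs _~_ (row i js)
  row-clique i js! = All.map⁺ (All.tabulate (λ _ → part₁~edge)) ∷ AllPairs.map⁺ (AllPairs.map sameRow js!)

  edge~row : ∀ i j {js} → All (_≢ j) js → All (edge i j ~_) (row i js)
  edge~row i j js≢j = edge~part₁ ∷ All.map⁺ (All.map (λ j′≢j → sameRow (j′≢j ∘ sym)) js≢j)

  embed-clique : ∀ {ws} → AllPairs _~_ ws → AllPairs (Adj MG) (map embed ws)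
  embed-clique = AllPairs.map⁺ ∘ AllPairs.map ~⇒adj

  embed-adjacent : ∀ {w ws} → All (w ~_) ws → All (Adj MG (embed w)) (map embed ws)
  embed-adjacent = All.map⁺ ∘ All.map ~⇒adj

  n₂<deg-edge : ∀ i j → suc n₂ ≤ deg MG (embed (edge i j))
  n₂<deg-edge i j = subst (_≤ deg MG (embed (edge i j))) length-neighbours
    (length≤deg MG (Unique.map⁺ embed-injective neighbours!) (embed-adjacent (edge~part₂ ∷ edge~row i j (allFinExcept-≢ j))))
    where
    neighbours! : Unique (part₂ j ∷ row i (allFinExcept j))
    neighbours! = ((λ ()) ∷ All.map⁺ (All.tabulate λ _ ()))
                ∷ AllPairs.map ~⇒≢ (row-clique i (allFinExcept⁺ j))
    length-neighbours : length (map embed (part₂ j ∷ row i (allFinExcept j))) ≡ suc n₂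
    length-neighbours = cong suc (trans (length-embed-row i (allFinExcept j)) (length-allFinExcept j))

  module LatinColouring (n₁≤n₂ : n₁ ≤ n₂) where

    latin : ℕ → ℕ → ℕ
    latin a b = (a + b) % suc n₂

    latin-cancelˡ : ∀ {a b b′} → a ≤ n₂ → b ≤ n₂ → b′ ≤ n₂ → latin a b ≡ latin a b′ → b ≡ b′
    latin-cancelˡ {a} a≤n₂ b≤n₂ b′≤n₂ = +-%-cancelˡ a (m≤n⇒m≤1+n a≤n₂) (s≤s b≤n₂) (s≤s b′≤n₂)

    latin-cancelʳ : ∀ {a a′ b} → a ≤ n₂ → a′ ≤ n₂ → b ≤ n₂ → latin a b ≡ latin a′ b → a ≡ a′
    latin-cancelʳ {a} {a′} {b} a≤n₂ a′≤n₂ b≤n₂ eq = latin-cancelˡ b≤n₂ a≤n₂ a′≤n₂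
      (trans (cong (_% suc n₂) (+-comm b a)) (trans eq (cong (_% suc n₂) (+-comm a′ b))))

    row≤n₂ : (i : Fin n₁) → toℕ i ≤ n₂
    row≤n₂ i = ≤-trans (<⇒≤ (toℕ<n i)) n₁≤n₂

    col≤n₂ : (j : Fin n₂) → toℕ j ≤ n₂
    col≤n₂ j = <⇒≤ (toℕ<n j)

    colour : (Fin n₂ → ℕ) → Vertex → ℕ
    colour q (part₁ i)  = latin (toℕ i) n₂
    colour q (part₂ j)  = q j
    colour q (edge i j) = latin (toℕ i) (toℕ j)

    Admissible : (Fin n₂ → ℕ) → Set
    Admissible q = ∀ (i : Fin n₁) j → q j ≢ latin (toℕ i) (toℕ j)

    colour-proper : ∀ {q w w′} → Admissible q → w ~ w′ → colour q w ≢ colour q w′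
    colour-proper _ (part₁~edge {i} {j}) eq =
      <-irrefl (sym (latin-cancelˡ (row≤n₂ i) ≤-refl (col≤n₂ j) eq)) (toℕ<n j)
    colour-proper {q} q! (edge~part₁ {i} {j}) = colour-proper {q} q! (part₁~edge {i} {j}) ∘ sym
    colour-proper q! (part₂~edge {i} {j}) = q! i j
    colour-proper q! (edge~part₂ {i} {j}) = q! i j ∘ sym
    colour-proper _ (sameRow {i} {j} {j′} j≢j′) =
      j≢j′ ∘ toℕ-injective ∘ latin-cancelˡ (row≤n₂ i) (col≤n₂ j) (col≤n₂ j′)
    colour-proper _ (sameCol {i} {i′} {j} i≢i′) =
      i≢i′ ∘ toℕ-injective ∘ latin-cancelʳ (row≤n₂ i) (row≤n₂ i′) (col≤n₂ j)

    colour-row< : ∀ q i js → All (λ w → colour q w < suc n₂) (row i js)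
    colour-row< q i js = m%n<n (toℕ i + n₂) (suc n₂) ∷ All.map⁺ (All.tabulate (λ {j} _ → m%n<n (toℕ i + toℕ j) (suc n₂)))

    colour<k : ∀ {q k} → suc n₂ ≤ k → (∀ j → q j < k) → ∀ w → colour q w < k
    colour<k suc-n₂≤k _   (part₁ i)  = <-≤-trans (m%n<n (toℕ i + n₂) (suc n₂)) suc-n₂≤k
    colour<k _        q<k (part₂ j)  = q<k j
    colour<k suc-n₂≤k _   (edge i j) = <-≤-trans (m%n<n (toℕ i + toℕ j) (suc n₂)) suc-n₂≤k

    colour-surjective : ∀ q (i₀ : Fin n₁) → toℕ i₀ ≡ 0 → ∀ t → t ≤ n₂ → ∃ λ w → colour q w ≡ t
    colour-surjective q i₀ i₀≡0 t t≤n₂ with m≤n⇒m<n∨m≡n t≤n₂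
    ... | inj₁ t<n₂ = edge i₀ (fromℕ< t<n₂) ,
          trans (cong₂ latin i₀≡0 (toℕ-fromℕ< t<n₂)) (m≤n⇒m%n≡m t≤n₂)
    ... | inj₂ refl = part₁ i₀ , trans (cong (λ a → latin a n₂) i₀≡0) (m≤n⇒m%n≡m t≤n₂)

    module Realise {k} (q : Fin n₂ → ℕ) (q! : Admissible q) (colour<k : ∀ w → colour q w < k) where

      c : Fin (n MG) → Fin k
      c u = fromℕ< (colour<k (decode u))

      toℕ-c : ∀ u → toℕ (c u) ≡ colour q (decode u)
      toℕ-c u = toℕ-fromℕ< (colour<k (decode u))

      toℕ-c-embed : ∀ w → toℕ (c (embed w)) ≡ colour q w
      toℕ-c-embed w = trans (toℕ-c (embed w)) (cong (colour q) (decode-embed w))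

      c-embed : ∀ w t → colour q w ≡ toℕ t → c (embed w) ≡ t
      c-embed w t eq = toℕ-injective (trans (toℕ-c-embed w) eq)

      proper : Proper MG c
      proper u v u~v cu≡cv = colour-proper {w = decode u} {decode v} q! (adj⇒~ decoded-adjacent) (begin
        colour q (decode u)  ≡⟨ toℕ-c u ⟨
        toℕ (c u)            ≡⟨ cong toℕ cu≡cv ⟩
        toℕ (c v)            ≡⟨ toℕ-c v ⟩
        colour q (decode v)  ∎)
        where
        open ≡-Reasoning
        decoded-adjacent : Adj MG (embed (decode u)) (embed (decode v))
        decoded-adjacent = subst₂ (Adj MG) (sym (embed-decode u)) (sym (embed-decode v)) (from T-≡ u~v)

      open ProperColouring MG c proper

      row-colours! : ∀ i {js} → Unique js → Unique (map c (map embed (row i js)))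
      row-colours! i js! = clique⇒Unique-colours (embed-clique (row-clique i js!))

      n₂≤nbColours-edge : ∀ i j → n₂ ≤ nbColours MG c (embed (edge i j))
      n₂≤nbColours-edge i j = subst (_≤ nbColours MG c (embed (edge i j)))
        (trans (length-embed-row i (allFinExcept j)) (length-allFinExcept j))
        (length≤nbColours (embed-adjacent (edge~row i j (allFinExcept-≢ j))) (row-colours! i (allFinExcept⁺ j)))

      n₂<nbColours-edge : ∀ i j → n₂ < q j → suc n₂ ≤ nbColours MG c (embed (edge i j))
      n₂<nbColours-edge i j n₂<qj = subst (_≤ nbColours MG c (embed (edge i j)))
        (cong suc (trans (length-embed-row i (allFinExcept j)) (length-allFinExcept j)))
        (length≤nbColours (embed-adjacent (edge~part₂ ∷ edge~row i j (allFinExcept-≢ j)))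
                          (fresh ∷ row-colours! i (allFinExcept⁺ j)))
        where
        fresh : All (c (embed (part₂ j)) ≢_) (map c (map embed (row i (allFinExcept j))))
        fresh = All.map⁺ (All.map⁺ (All.map (λ {w} w<suc-n₂ cj≡cw →
          <-irrefl (trans (sym (toℕ-c-embed w)) (trans (cong toℕ (sym cj≡cw)) (toℕ-c-embed (part₂ j))))
                   (<-≤-trans w<suc-n₂ n₂<qj))
          (colour-row< q i (allFinExcept j))))

      C2 : ∀ {r} → (∀ i j → r ≤ nbColours MG c (embed (edge i j))) → ∀ v → deg MG v ⊓ r ≤ nbColours MG c v
      C2 {r} r≤n₂≤nbColours-edge v with embed-surjective v
      ... | part₁ i  , refl = ≤-trans (m⊓n≤m _ r) (NbhdIsClique⇒deg≤nbColours (middle-vertex-NbhdIsClique KG _))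
      ... | part₂ j  , refl = ≤-trans (m⊓n≤m _ r) (NbhdIsClique⇒deg≤nbColours (middle-vertex-NbhdIsClique KG _))
      ... | edge i j , refl = ≤-trans (m⊓n≤n _ r) (r≤n₂≤nbColours-edge i j)

  module Bounds (1≤n₁ : 1 ≤ n₁) (n₁≤n₂ : n₁ ≤ n₂) where

    open LatinColouring n₁≤n₂

    private
      i₀ : Fin n₁
      i₀ = fromℕ< 1≤n₁

      j₀ : Fin n₂
      j₀ = fromℕ< (≤-trans 1≤n₁ n₁≤n₂)

      n₂+1≡1+n₂ : n₂ + 1 ≡ suc n₂
      n₂+1≡1+n₂ = +-comm n₂ 1

      n₂+2≡2+n₂ : n₂ + 2 ≡ suc (suc n₂)
      n₂+2≡2+n₂ = +-comm n₂ 2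

    n₂<maxDeg : suc n₂ ≤ maxDeg MG
    n₂<maxDeg = ≤-trans (n₂<deg-edge i₀ j₀) (deg≤maxDeg MG _)

    colours≥n₂+1 : ∀ {k r} → HasCondColouring MG k r → n₂ + 1 ≤ k
    colours≥n₂+1 {k} has = subst (_≤ k) length-row₀
      (HasCondColouring⇒clique≤k has (embed-clique (row-clique i₀ (Unique.allFin⁺ n₂))))
      where
      length-row₀ : length (map embed (row i₀ (allFin n₂))) ≡ n₂ + 1
      length-row₀ = trans (length-embed-row i₀ (allFin n₂)) (trans (cong suc (length-allFin n₂)) (sym n₂+1≡1+n₂))

    colours≥n₂+2 : ∀ {k} → HasCondColouring MG k (n₂ + 1) → n₂ + 2 ≤ k
    colours≥n₂+2 {k} has = subst (_≤ k) (sym (+-suc n₂ 1))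
      (HasCondColouring⇒r<k (embed (edge i₀ j₀)) has (subst (_≤ deg MG (embed (edge i₀ j₀))) (sym n₂+1≡1+n₂) (n₂<deg-edge i₀ j₀)))

    colouring-r≤n₂ : ∀ r → 1 ≤ r → r ≤ n₂ → HasCondColouring MG (n₂ + 1) r
    colouring-r≤n₂ r 1≤r r≤n₂ =
      c , subst (0 <_) (sym n₂+1≡1+n₂) (s≤s z≤n) , 1≤r , ≤-trans (m≤n⇒m≤1+n r≤n₂) n₂<maxDeg ,
      subst (r ≤_) (sym n₂+1≡1+n₂) (m≤n⇒m≤1+n r≤n₂) ,
      surjective , proper , C2 (λ i j → ≤-trans r≤n₂ (n₂≤nbColours-edge i j))
      where
      lastRow : Fin n₂ → ℕ
      lastRow j = latin n₂ (toℕ j)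

      lastRow-admissible : Admissible lastRow
      lastRow-admissible i j eq =
        <-irrefl (sym (latin-cancelʳ ≤-refl (row≤n₂ i) (col≤n₂ j) eq)) (<-≤-trans (toℕ<n i) n₁≤n₂)

      colour<n₂+1 : ∀ w → colour lastRow w < n₂ + 1
      colour<n₂+1 = subst (λ k → ∀ w → colour lastRow w < k) (sym n₂+1≡1+n₂)
        (colour<k ≤-refl (λ j → m%n<n (n₂ + toℕ j) (suc n₂)))

      open Realise lastRow lastRow-admissible colour<n₂+1

      surjective : ∀ t → ∃ λ u → c u ≡ t
      surjective t with colour-surjective lastRow i₀ (toℕ-fromℕ< 1≤n₁) (toℕ t)
                          (s≤s⁻¹ (subst (toℕ t <_) n₂+1≡1+n₂ (toℕ<n t)))
      ... | w , eq = embed w , c-embed w t eq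

    colouring-r≡n₂+1 : HasCondColouring MG (n₂ + 2) (n₂ + 1)
    colouring-r≡n₂+1 =
      c , subst (0 <_) (sym n₂+2≡2+n₂) (s≤s z≤n) , subst (0 <_) (sym n₂+1≡1+n₂) (s≤s z≤n) ,
      subst (_≤ maxDeg MG) (sym n₂+1≡1+n₂) n₂<maxDeg , +-monoʳ-≤ n₂ (n≤1+n 1) ,
      surjective , proper , C2 (λ i j → subst (_≤ nbColours MG c (embed (edge i j))) (sym n₂+1≡1+n₂) (n₂<nbColours-edge i j ≤-refl))
      where
      fresh : Fin n₂ → ℕ
      fresh _ = suc n₂

      fresh-admissible : Admissible fresh
      fresh-admissible i j eq = <-irrefl (sym eq) (m%n<n (toℕ i + toℕ j) (suc n₂))

      colour<n₂+2 : ∀ w → colour fresh w < n₂ + 2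
      colour<n₂+2 = subst (λ k → ∀ w → colour fresh w < k) (sym n₂+2≡2+n₂) (colour<k (n≤1+n _) (λ _ → ≤-refl))

      open Realise fresh fresh-admissible colour<n₂+2

      surjective : ∀ t → ∃ λ u → c u ≡ t
      surjective t with m≤n⇒m<n∨m≡n (s≤s⁻¹ (subst (toℕ t <_) n₂+2≡2+n₂ (toℕ<n t)))
      ... | inj₁ t<1+n₂ with colour-surjective fresh i₀ (toℕ-fromℕ< 1≤n₁) (toℕ t) (s≤s⁻¹ t<1+n₂)
      ...   | w , eq = embed w , c-embed w t eq
      surjective t | inj₂ t≡1+n₂ = embed (part₂ j₀) , c-embed (part₂ j₀) t (sym t≡1+n₂)

proposition3p9 : (n₁ n₂ : ℕ) → 1 ≤ n₁ → n₁ ≤ n₂ →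
    ((r : ℕ) → 1 ≤ r → r ≤ n₂ → ChiR≡ (middle (K n₁ n₂)) r (n₂ + 1))
    × ChiR≡ (middle (K n₁ n₂)) (n₂ + 1) (n₂ + 2)
proposition3p9 n₁ n₂ 1≤n₁ n₁≤n₂ =
  (λ r 1≤r r≤n₂ → ChiR≡-intro (colouring-r≤n₂ r 1≤r r≤n₂) colours≥n₂+1) ,
  ChiR≡-intro colouring-r≡n₂+1 colours≥n₂+2
  where open MiddleK.Bounds n₁ n₂ 1≤n₁ n₁≤n₂
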